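{- Let $r \ge 2$ and $d \in \mathbb{N}$, and let $\mathcal{G}$ be a $d$-regular quasi-bipartite $r$-uniform hypergraph on $n$ vertices. Then \[ \operatorname{ind}(\mathcal{G}) \le \operatorname{ind}(\mathcal{H}^r_d)^{n/(rd)}, \] where $\operatorname{ind}(\mathcal{H}^r_d) = 2^{(r-1)d} + (2^d-1)(2^{r-1}-1)^{d}$.
   Context: An $r$-uniform hypergraph ($r$-graph) has edges that are $r$-element subsets of its vertex set. A set of vertices is independent if it contains no edge; $\operatorname{ind}(\mathcal{G})$ denotes the number of independent sets of $\mathcal{G}$, including the empty set. The degree of a vertex is the number of edges containing it; $\mathcal{G}$ is $d$-regular if every vertex has degree $d$. The link $\mathcal{L}(v)$ of a vertex $v$ is the $(r-1)$-graph whose edges are the sets $S$ such that $S \cup \{v\}$ is an edge of $\mathcal{G}$, and whose vertex set is the union of these edges. An $r$-graph $\mathcal{G}$ is quasi-bipartite if its vertex set can be partitioned into sets $A$ and $B$ such that (i) every edge of $\mathcal{G}$ contains exactly one vertex of $A$, and (ii) for each $a \in A$, the link $\mathcal{L}(a)$ is a matching, i.e. its edges are pairwise disjoint. The $r$-graph $\mathcal{H}^r_d$ is defined on $rd$ vertices as follows: fix a set $M$ of $d$ vertices and partition the remaining $(r-1)d$ vertices into $d$ disjoint sets $T_1,\dots,T_d$ of size $r-1$. The edges of $\mathcal{H}^r_d$ are the $d^2$ sets $\{m\} \cup T_i$ with $m \in M$ and $1 \le i \le d$. The graph $\mathcal{H}^r_d$ is $d$-regular and has exactly $2^{(r-1)d}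 + (2^d-1)(2^{r-1}-1)^{d}$ independent sets. -}

module Defs where

open import Data.Nat using (ℕ; zero; suc; _+_; _*_; _∸_; _^_; _≤_)
open import Data.Bool using (Bool; true; false; _∧_; not)
open import Data.List using (List; []; _∷_; _++_; map; length; filterᵇ)
open import Data.Bool.ListAction using (any)
open import Data.Vec using (Vec; []; _∷_)
open import Data.Fin using (Fin)
open import Data.Fin.Subset using (Subset; _∈_; _⊆_; _∩_; _-_; ∣_∣; Empty)
open import Data.Fin.Subset.Properties using (_∈?_; _⊆?_)
open import Relation.Nullary using (¬_)
open import Relation.Nullary.Decidable using (⌊_⌋)
open import Relation.Binary.PropositionalEquality using (_≡_)
open import Data.Product using (∃-syntax; _×_)

allSubsets : (n : ℕ) → List (Subset n)
allSubsets zero    = [] ∷ []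
allSubsets (suc n) = map (false ∷_) (allSubsets n) ++ map (true ∷_) (allSubsets n)

-- A hypergraph on the vertex set Fin n, given by a decidable edge predicate
-- on subsets of Fin n (so edges form a finite set, without multiplicity).
Hypergraph : ℕ → Set
Hypergraph n = Subset n → Bool

IsEdge : ∀ {n} → Hypergraph n → Subset n → Set
IsEdge G e = G e ≡ true

Uniform : ∀ {n} → ℕ → Hypergraph n → Set
Uniform r G = ∀ e → IsEdge G e → ∣ e ∣ ≡ r

degree : ∀ {n} → Hypergraph n → Fin n → ℕ
degree {n} G v = length (filterᵇ (λ e → G e ∧ ⌊ v ∈? e ⌋) (allSubsets n))

Regular : ∀ {n} → ℕ → Hypergraph n → Set
Regular d G = ∀ v → degree G v ≡ d

isIndependent : ∀ {n} → Hypergraph n → Subset n → Bool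
isIndependent {n} G S = not (any (λ e → G e ∧ ⌊ e ⊆? S ⌋) (allSubsets n))

ind : ∀ {n} → Hypergraph n → ℕ
ind {n} G = length (filterᵇ (isIndependent G) (allSubsets n))

-- Quasi-bipartite: a set A (with B its complement) such that
--  (i) every edge meets A in exactly one vertex, and
--  (ii) for each a ∈ A the link L(a) is a matching: the link edges
--       e - a and f - a coming from distinct edges e ≢ f through a
--       are disjoint.
QuasiBipartite : ∀ {n} → Hypergraph n → Set
QuasiBipartite {n} G =
  ∃[ A ] ((∀ e → IsEdge G e → ∣ e ∩ A ∣ ≡ 1)
         × (∀ a → a ∈ A → ∀ e f → IsEdge G e → IsEdge G f → a ∈ e → a ∈ f →
              ¬ (e ≡ f) → Empty ((e - a) ∩ (f - a))))

indH : ℕ → ℕ → ℕ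
indH r d = 2 ^ ((r ∸ 1) * d) + (2 ^ d ∸ 1) * (2 ^ (r ∸ 1) ∸ 1) ^ d

-- An independent set is y ∪ z with y ⊆ B, z ⊆ A.  Fixing y, a
-- vertex a ∈ A may lie in z only if it is free, i.e. y contains no edge of
-- the link of a; so the number K(y) of such z is at most ∏_{a ∈ A} w_a(y),
-- where w_a(y) = 2 if a is free and 1 otherwise.  The function w_a depends
-- only on the neighbourhood N(a) ⊆ B, and every vertex of B lies in exactly
-- d of these neighbourhoods.  Finner's inequality (a generalised Hölder
-- inequality on the cube of subsets) therefore gives
--   ind(G)ᵈ = (∑_{y ⊆ B} K(y))ᵈ ≤ ∏_{a ∈ A} ∑_{y ⊆ N(a)} w_a(y)ᵈ = ind(Hʳ_d)^|A|,
-- the last sum being computed from the fact that the link of a is a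
-- matching of d sets of size r − 1.  Double counting shows n = r·|A|.
module Submission where

open import Defs
open import Data.Nat using (ℕ; zero; suc; _+_; _*_; _∸_; _^_; _≤_; _<_; _≤?_; _<?_; z≤n; s≤s; NonZero)
open import Data.Nat.Properties
open import Data.Nat.ListAction using (sum; product)
open import Data.Nat.ListAction.Properties using (sum-++)
open import Data.Nat.Tactic.RingSolver using (solve-∀)
open import Data.Bool using (Bool; true; false; _∧_; _∨_; not; if_then_else_)
open import Data.Bool.Properties using (T-≡; T-∧; not-involutive)
open import Data.Bool.ListAction using (any)
open import Data.List using (List; []; _∷_; length; map; _++_; filterᵇ)
open import Data.List.Properties using (length-map; map-++; map-∘; map-cong)
open import Data.List.Membership.Propositional using (find; lose) renaming (_∈_ to _∈ₗ_)
open import Data.List.Membership.Propositional.Properties using (∈-filter⁻; ∈-map⁺; ∈-map⁻; ∈-++⁺ˡ; ∈-++⁺ʳ)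
open import Data.List.Relation.Unary.Any using (Any; here; there)
import Data.List.Relation.Unary.Any as Any
open import Data.List.Relation.Unary.Any.Properties using (any⁺; any⁻)
open import Data.List.Relation.Unary.All using (All; []; _∷_; all?)
import Data.List.Relation.Unary.All as All
open import Data.List.Relation.Unary.All.Properties using (¬All⇒Any¬)
import Data.List.Relation.Unary.All.Properties as All
open import Data.List.Relation.Unary.AllPairs using (AllPairs; []; _∷_)
import Data.List.Relation.Unary.AllPairs.Properties as AllPairs
open import Data.List.Relation.Unary.Unique.Propositional using (Unique)
import Data.List.Relation.Unary.Unique.Propositional.Properties as Unique
open import Data.Product using (_×_; _,_; proj₁; proj₂)
open import Data.Sum using (inj₁; inj₂)
open import Data.Fin using (Fin; zero; suc) renaming (_≟_ to _≟ᶠ_)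
open import Data.Vec using (Vec; []; _∷_; head; tail; lookup; tabulate)
import Data.Vec.Base as Vec
open import Data.Vec.Properties using (∷-injectiveʳ; lookup-zipWith; lookup-replicate; lookup-map; []=⇒lookup; lookup⇒[]=; lookup∘tabulate)
open import Data.Fin.Subset using (Subset; _∈_; _⊆_; _∩_; _∪_; _-_; ⊤; ⊥; ∁; ∣_∣; ⋃; ⁅_⁆; Empty)
open import Data.Fin.Subset.Properties using (_∈?_; _⊆?_; out⊆; s⊆s; drop-∷-⊆; ⊆-trans; p⊆p∪q; q⊆p∪q; x∈p∩q⁺; x∈p∩q⁻; ∉⊥; Empty-unique; ∩-comm; ∪-comm; ∩-zeroʳ; ∩-distribˡ-∪; ∪-identityˡ; ∩-identityʳ; ∣⊥∣≡0; ∣⊤∣≡n; p∪∁p≡⊤; p─⊥≡p; p─q⊆p; x∈p∧x≢y⇒x∈p-y)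
open import Function using (_∘_)
open import Function.Bundles using (Equivalence)
open import Relation.Binary.PropositionalEquality
open import Relation.Nullary using (¬_; yes; no; contradiction)
open import Relation.Nullary.Decidable using (⌊_⌋; T?)

^-distribʳ-* : ∀ x y n → (x * y) ^ n ≡ x ^ n * y ^ n
^-distribʳ-* x y zero = refl
^-distribʳ-* x y (suc n) = begin
  x * y * (x * y) ^ n       ≡⟨ cong (x * y *_) (^-distribʳ-* x y n) ⟩
  x * y * (x ^ n * y ^ n)   ≡⟨ interchange x y (x ^ n) (y ^ n) ⟩
  x * x ^ n * (y * y ^ n)   ∎
  where
  open ≡-Reasoning
  interchange : ∀ a b c e → a * b * (c * e) ≡ a * c * (b * e)
  interchange = solve-∀

^-cancelʳ-≤ : ∀ d .{{_ : NonZero d}} {x y} → x ^ d ≤ y ^ d → x ≤ y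
^-cancelʳ-≤ d {x} {y} le with x ≤? y
... | yes x≤y = x≤y
... | no x≰y = contradiction le (<⇒≱ (^-monoˡ-< d (≰⇒> x≰y)))

^-≤0⇒≡0 : ∀ d .{{_ : NonZero d}} {x} → x ^ d ≤ 0 → x ≡ 0
^-≤0⇒≡0 d@(suc _) le = n≤0⇒n≡0 (^-cancelʳ-≤ d le)

record Pick (P : ℕ → Set) (xs : List ℕ) : Set where
  constructor picked
  field
    x          : ℕ
    rest       : List ℕ
    px         : P x
    sum-eq     : sum xs ≡ x + sum rest
    product-eq : product xs ≡ x * product rest
    length-eq  : length xs ≡ suc (length rest)

pick : ∀ {P} xs → Any P xs → Pick P xs
pick (x ∷ xs) (here px) = picked x xs px refl refl refl
pick (y ∷ xs) (there p) with pick xs p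
... | picked x rest px se pe le =
  picked x (y ∷ rest) px
    (trans (cong (y +_) se) (+-left-comm y x (sum rest)))
    (trans (cong (y *_) pe) (*-left-comm y x (product rest)))
    (cong suc le)
  where
  +-left-comm : ∀ a b c → a + (b + c) ≡ b + (a + c)
  +-left-comm = solve-∀
  *-left-comm : ∀ a b c → a * (b * c) ≡ b * (a * c)
  *-left-comm = solve-∀

sum-all-< : ∀ S xs → All (_< S) xs → sum xs + length xs ≤ length xs * S
sum-all-< S [] [] = z≤n
sum-all-< S (x ∷ xs) (x<S ∷ xs<S) = begin
  x + sum xs + suc (length xs)   ≡⟨ shuffle x (sum xs) (length xs) ⟩
  suc x + (sum xs + length xs)   ≤⟨ +-mono-≤ x<S (sum-all-< S xs xs<S) ⟩
  S + length xs * S              ∎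
  where
  open ≤-Reasoning
  shuffle : ∀ a b c → a + b + suc c ≡ suc a + (b + c)
  shuffle = solve-∀

sum-all-> : ∀ S xs → All (S <_) xs → length xs * S + length xs ≤ sum xs
sum-all-> S [] [] = z≤n
sum-all-> S (x ∷ xs) (S<x ∷ S<xs) = begin
  S + length xs * S + suc (length xs)   ≡⟨ shuffle S (length xs * S) (length xs) ⟩
  suc S + (length xs * S + length xs)   ≤⟨ +-mono-≤ S<x (sum-all-> S xs S<xs) ⟩
  x + sum xs                            ∎
  where
  open ≤-Reasoning
  shuffle : ∀ a b c → a + b + suc c ≡ suc a + (b + c)
  shuffle = solve-∀

some-≥-mean : ∀ S xs → 1 ≤ length xs → length xs * S ≤ sum xs → Any (S ≤_) xs
some-≥-mean S xs nonempty mean≤sum with all? (_<? S) xs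
... | no ¬all< = Any.map ≮⇒≥ (¬All⇒Any¬ (_<? S) xs ¬all<)
... | yes all< = contradiction (begin
  1 + sum xs             ≤⟨ +-monoˡ-≤ (sum xs) nonempty ⟩
  length xs + sum xs     ≡⟨ +-comm (length xs) (sum xs) ⟩
  sum xs + length xs     ≤⟨ sum-all-< S xs all< ⟩
  length xs * S          ≤⟨ mean≤sum ⟩
  sum xs                 ∎) 1+n≰n
  where open ≤-Reasoning

some-≤-mean : ∀ S xs → 1 ≤ length xs → sum xs ≤ length xs * S → Any (_≤ S) xs
some-≤-mean S xs nonempty sum≤mean with all? (S <?_) xs
... | no ¬all> = Any.map ≮⇒≥ (¬All⇒Any¬ (S <?_) xs ¬all>)
... | yes all> = contradiction (begin
  1 + length xs * S            ≡⟨ +-comm 1 (length xs * S) ⟩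
  length xs * S + 1            ≤⟨ +-monoʳ-≤ (length xs * S) nonempty ⟩
  length xs * S + length xs    ≤⟨ sum-all-> S xs all> ⟩
  sum xs                       ≤⟨ sum≤mean ⟩
  length xs * S                ∎) 1+n≰n
  where open ≤-Reasoning

smoothing : ∀ S x y → S ≤ x → y ≤ S → x * y ≤ S * (x + y ∸ S)
smoothing S x y S≤x y≤S = begin
  x * y               ≡⟨ cong (_* y) (sym (m+[n∸m]≡n S≤x)) ⟩
  (S + e) * y         ≡⟨ *-distribʳ-+ y S e ⟩
  S * y + e * y       ≤⟨ +-monoʳ-≤ (S * y) (*-monoʳ-≤ e y≤S) ⟩
  S * y + e * S       ≡⟨ cong (S * y +_) (*-comm e S) ⟩
  S * y + S * e       ≡⟨ sym (*-distribˡ-+ S y e) ⟩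
  S * (y + e)         ≡⟨ cong (S *_) (sym excess) ⟩
  S * (x + y ∸ S)     ∎
  where
  open ≤-Reasoning
  e = x ∸ S
  excess : x + y ∸ S ≡ y + e
  excess = trans (cong (_∸ S) (+-comm x y)) (+-∸-assoc y S≤x)

AM-GM-mean : ℕ → Set
AM-GM-mean k = ∀ S xs → length xs ≡ k → sum xs ≡ k * S → product xs ≤ S ^ k

-- One smoothing move: if x ≥ S ≥ y and x, y, zs (k + 2 numbers) sum to
-- (k + 2)·S, then replacing x, y by S and x + y − S leaves k + 1 numbers
-- with mean S, to which the induction hypothesis applies.
am-gm-smooth : ∀ k → AM-GM-mean (suc k) → ∀ S x y zs → S ≤ x → y ≤ S → length zs ≡ k →
  x + (y + sum zs) ≡ suc (suc k) * S → x * (y * product zs) ≤ S ^ suc (suc k)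
am-gm-smooth k ih S x y zs S≤x y≤S length-zs sum≡ = begin
  x * (y * product zs)          ≡⟨ sym (*-assoc x y _) ⟩
  x * y * product zs            ≤⟨ *-monoˡ-≤ (product zs) (smoothing S x y S≤x y≤S) ⟩
  S * z * product zs            ≡⟨ *-assoc S z _ ⟩
  S * (z * product zs)          ≤⟨ *-monoʳ-≤ S (ih S (z ∷ zs) (cong suc length-zs) new-sum) ⟩
  S * S ^ suc k                 ∎
  where
  open ≤-Reasoning
  z = x + y ∸ S
  new-sum : z + sum zs ≡ suc k * S
  new-sum = +-cancelˡ-≡ S _ _ (begin-equality
    S + (z + sum zs)          ≡⟨ sym (+-assoc S z _) ⟩
    S + z + sum zs            ≡⟨ cong (_+ sum zs) (m+[n∸m]≡n (≤-trans S≤x (m≤m+n x y))) ⟩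
    x + y + sum zs            ≡⟨ +-assoc x y _ ⟩
    x + (y + sum zs)          ≡⟨ sum≡ ⟩
    S + suc k * S             ∎)

-- The induction step: some entry x is at least the mean S, and then some
-- other entry y is at most S.
am-gm-step : ∀ k → AM-GM-mean (suc k) → AM-GM-mean (suc (suc k))
am-gm-step k ih S xs len≡ sum≡ = pick-y (pick xs (some-≥-mean S xs (length-pos xs len≡) mean≤sum))
  where
  length-pos : ∀ (ws : List ℕ) {m} → length ws ≡ suc m → 1 ≤ length ws
  length-pos ws eq = subst (1 ≤_) (sym eq) (s≤s z≤n)
  mean≤sum : length xs * S ≤ sum xs
  mean≤sum = ≤-reflexive (trans (cong (_* S) len≡) (sym sum≡))
  pick-y : Pick (S ≤_) xs → product xs ≤ S ^ suc (suc k)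
  pick-y (picked x ys S≤x sum-x product-x length-x) = finish (pick ys (some-≤-mean S ys (length-pos ys ys-length) ys-sum≤))
    where
    ys-length : length ys ≡ suc k
    ys-length = suc-injective (trans (sym length-x) len≡)
    ys-sum≤ : sum ys ≤ length ys * S
    ys-sum≤ = +-cancelˡ-≤ S _ _ (begin
      S + sum ys                ≤⟨ +-monoˡ-≤ (sum ys) S≤x ⟩
      x + sum ys                ≡⟨ trans (sym sum-x) sum≡ ⟩
      S + suc k * S             ≡⟨ cong (λ m → S + m * S) (sym ys-length) ⟩
      S + length ys * S         ∎)
      where open ≤-Reasoning
    finish : Pick (_≤ S) ys → product xs ≤ S ^ suc (suc k)
    finish (picked y zs y≤S sum-y product-y length-y) =
      subst (_≤ S ^ suc (suc k)) (sym (trans product-x (cong (x *_) product-y)))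
        (am-gm-smooth k ih S x y zs S≤x y≤S (suc-injective (trans (sym length-y) ys-length))
          (trans (cong (x +_) (sym sum-y)) (trans (sym sum-x) sum≡)))

am-gm-mean : ∀ k → AM-GM-mean k
am-gm-mean zero S [] refl _ = ≤-refl
am-gm-mean (suc zero) S (x ∷ []) refl sum≡ = *-monoˡ-≤ 1 (≤-reflexive x≡S)
  where
  x≡S : x ≡ S
  x≡S = trans (sym (+-identityʳ x)) (trans sum≡ (+-identityʳ S))
am-gm-mean (suc (suc k)) = am-gm-step k (am-gm-mean (suc k))

sum-map-* : ∀ c ys → sum (map (c *_) ys) ≡ c * sum ys
sum-map-* c [] = sym (*-zeroʳ c)
sum-map-* c (y ∷ ys) = trans (cong (c * y +_) (sum-map-* c ys)) (sym (*-distribˡ-+ c y (sum ys)))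

product-map-* : ∀ c ys → product (map (c *_) ys) ≡ c ^ length ys * product ys
product-map-* c [] = refl
product-map-* c (y ∷ ys) = trans (cong (c * y *_) (product-map-* c ys)) (interchange c y (c ^ length ys) (product ys))
  where
  interchange : ∀ a b c e → a * b * (c * e) ≡ a * c * (b * e)
  interchange = solve-∀

-- AM–GM: kᵏ · ∏ ys ≤ (∑ ys)ᵏ for a list ys of length k (apply the mean
-- version to the list k · ys, whose mean is ∑ ys).
am-gm : ∀ ys → length ys ^ length ys * product ys ≤ sum ys ^ length ys
am-gm ys = subst (_≤ sum ys ^ k) (product-map-* k ys)
  (am-gm-mean k (sum ys) (map (k *_) ys) (length-map (k *_) ys) (sum-map-* k ys))
  where k = length ys

-- Minkowski-type inequality: if aᵈ·c ≤ P·Xᵈ and bᵈ·c ≤ P·Yᵈ then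
-- (a + b)ᵈ·c ≤ P·(X + Y)ᵈ.  Reading ratios, if a/X ≥ b/Y then
-- (a + b)/(X + Y) ≤ a/X, so the bound for the dominant side suffices.
minkowski-dominant : ∀ d a b c P X Y .{{_ : NonZero X}} → b * X ≤ a * Y →
  a ^ d * c ≤ P * X ^ d → (a + b) ^ d * c ≤ P * (X + Y) ^ d
minkowski-dominant d a b c P X Y bX≤aY ha = *-cancelʳ-≤ _ _ (X ^ d) {{m^n≢0 X d}} (begin
  (a + b) ^ d * c * X ^ d       ≡⟨ regroup ((a + b) ^ d) c (X ^ d) ⟩
  (a + b) ^ d * X ^ d * c       ≡⟨ cong (_* c) (sym (^-distribʳ-* (a + b) X d)) ⟩
  ((a + b) * X) ^ d * c         ≤⟨ *-monoˡ-≤ c (^-monoˡ-≤ d ratio) ⟩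
  (a * (X + Y)) ^ d * c         ≡⟨ cong (_* c) (^-distribʳ-* a (X + Y) d) ⟩
  a ^ d * (X + Y) ^ d * c       ≡⟨ regroup (a ^ d) ((X + Y) ^ d) c ⟩
  a ^ d * c * (X + Y) ^ d       ≤⟨ *-monoˡ-≤ ((X + Y) ^ d) ha ⟩
  P * X ^ d * (X + Y) ^ d       ≡⟨ regroup P (X ^ d) ((X + Y) ^ d) ⟩
  P * (X + Y) ^ d * X ^ d       ∎)
  where
  open ≤-Reasoning
  regroup : ∀ p q r → p * q * r ≡ p * r * q
  regroup = solve-∀
  ratio : (a + b) * X ≤ a * (X + Y)
  ratio = begin
    (a + b) * X     ≡⟨ *-distribʳ-+ X a b ⟩
    a * X + b * X   ≤⟨ +-monoʳ-≤ (a * X) bX≤aY ⟩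
    a * X + a * Y   ≡⟨ sym (*-distribˡ-+ a X Y) ⟩
    a * (X + Y)     ∎

-- The degenerate case X = 0: then aᵈ·c = 0, so a = 0 or c = 0.
minkowski-degenerate : ∀ d .{{_ : NonZero d}} a b c P Y → a ^ d * c ≤ P * 0 ^ d →
  b ^ d * c ≤ P * Y ^ d → (a + b) ^ d * c ≤ P * (0 + Y) ^ d
minkowski-degenerate d@(suc _) a b c P Y ha hb
  with m*n≡0⇒m≡0∨n≡0 (a ^ d) (n≤0⇒n≡0 (≤-trans ha (≤-reflexive (*-zeroʳ P))))
... | inj₁ aᵈ≡0 rewrite m^n≡0⇒m≡0 a d aᵈ≡0 = hb
... | inj₂ refl rewrite *-zeroʳ ((a + b) ^ d) = z≤n

minkowski-ordered : ∀ d .{{_ : NonZero d}} a b c P X Y → b * X ≤ a * Y →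
  a ^ d * c ≤ P * X ^ d → b ^ d * c ≤ P * Y ^ d → (a + b) ^ d * c ≤ P * (X + Y) ^ d
minkowski-ordered d a b c P zero Y _ ha hb = minkowski-degenerate d a b c P Y ha hb
minkowski-ordered d a b c P X@(suc _) Y bX≤aY ha _ = minkowski-dominant d a b c P X Y bX≤aY ha

minkowski : ∀ d .{{_ : NonZero d}} a b c P X Y → a ^ d * c ≤ P * X ^ d →
  b ^ d * c ≤ P * Y ^ d → (a + b) ^ d * c ≤ P * (X + Y) ^ d
minkowski d a b c P X Y ha hb with ≤-total (b * X) (a * Y)
... | inj₁ bX≤aY = minkowski-ordered d a b c P X Y bX≤aY ha hb
... | inj₂ aY≤bX = subst₂ (λ s t → s ^ d * c ≤ P * t ^ d) (+-comm b a) (+-comm Y X)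
  (minkowski-ordered d b a c P Y X aY≤bX hb ha)

-- With G = ∏ (αᵢ + βᵢ), AM–GM applied to the "shares" αᵢ·G/(αᵢ + βᵢ) bounds
-- d·u by their sum (after clearing the d-th roots), likewise for w, and the
-- shares of α and β together sum to d·G; Minkowski combines the two bounds.

σ : ℕ × ℕ → ℕ
σ (α , β) = α + β

∏σ : List (ℕ × ℕ) → ℕ
∏σ ps = product (map σ ps)

-- shares f ps lists f(pᵢ) · ∏_{j ≠ i} σ(pⱼ).
shares : (ℕ × ℕ → ℕ) → List (ℕ × ℕ) → List ℕ
shares f [] = []
shares f (p ∷ ps) = f p * ∏σ ps ∷ map (σ p *_) (shares f ps)

length-shares : ∀ f ps → length (shares f ps) ≡ length ps
length-shares f [] = refl
length-shares f (p ∷ ps) = cong suc (trans (length-map (σ p *_) (shares f ps)) (length-shares f ps))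

-- ∏ᵢ f(pᵢ)·G/σ(pᵢ) = ∏ f(pᵢ) · G^(d−1), multiplied through by G.
product-shares : ∀ f ps → product (shares f ps) * ∏σ ps ≡ product (map f ps) * ∏σ ps ^ length ps
product-shares f [] = refl
product-shares f (p ∷ ps) = begin
  f p * G * product (map (σ p *_) (shares f ps)) * (σ p * G)
    ≡⟨ cong (λ t → f p * G * t * (σ p * G)) (product-map-* (σ p) (shares f ps)) ⟩
  f p * G * (σ p ^ length (shares f ps) * product (shares f ps)) * (σ p * G)
    ≡⟨ cong (λ k → f p * G * (σ p ^ k * product (shares f ps)) * (σ p * G)) (length-shares f ps) ⟩
  f p * G * (s ^ k * product (shares f ps)) * (s * G)
    ≡⟨ regroup (f p) s G (s ^ k) (product (shares f ps)) ⟩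
  f p * (s * s ^ k) * G * (product (shares f ps) * G)
    ≡⟨ cong (f p * (s * s ^ k) * G *_) (product-shares f ps) ⟩
  f p * (s * s ^ k) * G * (product (map f ps) * G ^ k)
    ≡⟨ regroup′ (f p) (s * s ^ k) G (product (map f ps)) (G ^ k) ⟩
  f p * product (map f ps) * ((s * s ^ k) * (G * G ^ k))
    ≡⟨ cong (f p * product (map f ps) *_) (sym (^-distribʳ-* s G (suc k))) ⟩
  f p * product (map f ps) * (s * G) ^ suc k ∎
  where
  open ≡-Reasoning
  G = ∏σ ps
  s = σ p
  k = length ps
  regroup : ∀ a s G S Y → a * G * (S * Y) * (s * G) ≡ a * (s * S) * G * (Y * G)
  regroup = solve-∀
  regroup′ : ∀ a S G P H → a * S * G * (P * H) ≡ a * P * (S * (G * H))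
  regroup′ = solve-∀

sum-shares : ∀ ps → sum (shares proj₁ ps) + sum (shares proj₂ ps) ≡ length ps * ∏σ ps
sum-shares [] = refl
sum-shares ((α , β) ∷ ps) = begin
  α * G + sum (map (s *_) (shares proj₁ ps)) + (β * G + sum (map (s *_) (shares proj₂ ps)))
    ≡⟨ cong₂ (λ x y → α * G + x + (β * G + y)) (sum-map-* s (shares proj₁ ps)) (sum-map-* s (shares proj₂ ps)) ⟩
  α * G + s * sum (shares proj₁ ps) + (β * G + s * sum (shares proj₂ ps))
    ≡⟨ regroup α β G (sum (shares proj₁ ps)) (sum (shares proj₂ ps)) ⟩
  s * G + s * (sum (shares proj₁ ps) + sum (shares proj₂ ps))
    ≡⟨ cong (λ t → s * G + s * t) (sum-shares ps) ⟩
  s * G + s * (length ps * G)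
    ≡⟨ regroup′ s G (length ps) ⟩
  suc (length ps) * (s * G) ∎
  where
  open ≡-Reasoning
  G = ∏σ ps
  s = α + β
  regroup : ∀ a b G x y → a * G + (a + b) * x + (b * G + (a + b) * y) ≡ (a + b) * G + (a + b) * (x + y)
  regroup = solve-∀
  regroup′ : ∀ s G k → s * G + s * (k * G) ≡ suc k * (s * G)
  regroup′ = solve-∀

product-≤-∏σ : ∀ f → (∀ p → f p ≤ σ p) → ∀ ps → product (map f ps) ≤ ∏σ ps
product-≤-∏σ f f≤σ [] = ≤-refl
product-≤-∏σ f f≤σ (p ∷ ps) = *-mono-≤ (f≤σ p) (product-≤-∏σ f f≤σ ps)

-- One side: from uᵈ ≤ P·∏f, AM–GM on the shares gives (d·u)ᵈ·Gᵈ ≤ P·G·(∑ shares)ᵈ.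
mahler-side : ∀ f ps P u → u ^ length ps ≤ P * product (map f ps) →
  (length ps * u) ^ length ps * ∏σ ps ^ length ps ≤ (P * ∏σ ps) * sum (shares f ps) ^ length ps
mahler-side f ps P u hu = begin
  (d * u) ^ d * G ^ d                         ≡⟨ cong (_* G ^ d) (^-distribʳ-* d u d) ⟩
  d ^ d * u ^ d * G ^ d                       ≤⟨ *-monoˡ-≤ (G ^ d) (*-monoʳ-≤ (d ^ d) hu) ⟩
  d ^ d * (P * product (map f ps)) * G ^ d    ≡⟨ regroup (d ^ d) P (product (map f ps)) (G ^ d) ⟩
  P * (d ^ d * (product (map f ps) * G ^ d))  ≡⟨ cong (λ t → P * (d ^ d * t)) (sym (product-shares f ps)) ⟩
  P * (d ^ d * (product ys * G))              ≡⟨ regroup′ P (d ^ d) (product ys) G ⟩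
  (P * G) * (d ^ d * product ys)              ≤⟨ *-monoʳ-≤ (P * G) am-gm-shares ⟩
  (P * G) * sum ys ^ d                        ∎
  where
  open ≤-Reasoning
  d = length ps
  G = ∏σ ps
  ys = shares f ps
  am-gm-shares : d ^ d * product ys ≤ sum ys ^ d
  am-gm-shares = subst (λ k → k ^ k * product ys ≤ sum ys ^ k) (length-shares f ps) (am-gm ys)
  regroup : ∀ D P A H → D * (P * A) * H ≡ P * (D * (A * H))
  regroup = solve-∀
  regroup′ : ∀ P D Y G → P * (D * (Y * G)) ≡ (P * G) * (D * Y)
  regroup′ = solve-∀

α-part β-part : List (ℕ × ℕ) → ℕ
α-part ps = product (map proj₁ ps)
β-part ps = product (map proj₂ ps)

¬NonZero⇒≡0 : ∀ {n} → ¬ NonZero n → n ≡ 0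
¬NonZero⇒≡0 {zero} _ = refl
¬NonZero⇒≡0 {suc n} ¬nz = contradiction _ ¬nz

-- If some αᵢ + βᵢ vanishes then so do both products, forcing u = w = 0.
mahler-degenerate : ∀ ps .{{_ : NonZero (length ps)}} P u w → ¬ NonZero (∏σ ps) →
  u ^ length ps ≤ P * α-part ps → w ^ length ps ≤ P * β-part ps → (u + w) ^ length ps ≤ P * ∏σ ps
mahler-degenerate ps@(_ ∷ _) P u w ¬G≢0 hu hw =
  subst (λ t → t ^ length ps ≤ P * ∏σ ps)
    (sym (cong₂ _+_ (vanishes proj₁ (λ (α , β) → m≤m+n α β) u hu) (vanishes proj₂ (λ (α , β) → m≤n+m β α) w hw)))
    z≤n
  where
  G≡0 : ∏σ ps ≡ 0
  G≡0 = ¬NonZero⇒≡0 ¬G≢0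
  vanishes : ∀ f → (∀ p → f p ≤ σ p) → ∀ x → x ^ length ps ≤ P * product (map f ps) → x ≡ 0
  vanishes f f≤σ x hx = ^-≤0⇒≡0 (length ps) (begin
    x ^ length ps             ≤⟨ hx ⟩
    P * product (map f ps)    ≤⟨ *-monoʳ-≤ P (product-≤-∏σ f f≤σ ps) ⟩
    P * ∏σ ps                 ≡⟨ cong (P *_) G≡0 ⟩
    P * 0                     ≡⟨ *-zeroʳ P ⟩
    0                         ∎)
    where open ≤-Reasoning

-- In the main case G > 0 the two one-sided bounds, combined by Minkowski,
-- give (d·u + d·w)ᵈ·Gᵈ ≤ P·G·(d·G)ᵈ; cancel dᵈ·Gᵈ.
mahler : ∀ ps .{{_ : NonZero (length ps)}} P u w →
  u ^ length ps ≤ P * α-part ps → w ^ length ps ≤ P * β-part ps → (u + w) ^ length ps ≤ P * ∏σ ps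
mahler ps P u w hu hw with nonZero? (∏σ ps)
... | no ¬G≢0 = mahler-degenerate ps P u w ¬G≢0 hu hw
... | yes G≢0 = *-cancelʳ-≤ _ _ (d ^ d * G ^ d) {{m*n≢0 _ _ {{m^n≢0 d d}} {{m^n≢0 G d {{G≢0}}}}}} (begin
  (u + w) ^ d * (d ^ d * G ^ d)    ≡⟨ regroup ((u + w) ^ d) (d ^ d) (G ^ d) ⟩
  (d ^ d * (u + w) ^ d) * G ^ d    ≡⟨ cong (_* G ^ d) (sym (^-distribʳ-* d (u + w) d)) ⟩
  (d * (u + w)) ^ d * G ^ d        ≡⟨ cong (λ t → t ^ d * G ^ d) (*-distribˡ-+ d u w) ⟩
  (d * u + d * w) ^ d * G ^ d      ≤⟨ minkowski d (d * u) (d * w) (G ^ d) (P * G) _ _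
                                        (mahler-side proj₁ ps P u hu) (mahler-side proj₂ ps P w hw) ⟩
  P * G * (sum (shares proj₁ ps) + sum (shares proj₂ ps)) ^ d ≡⟨ cong (λ t → P * G * t ^ d) (sum-shares ps) ⟩
  P * G * (d * G) ^ d              ≡⟨ cong (P * G *_) (^-distribʳ-* d G d) ⟩
  P * G * (d ^ d * G ^ d)          ∎)
  where
  open ≤-Reasoning
  d = length ps
  G = ∏σ ps
  regroup : ∀ x a b → x * (a * b) ≡ (a * x) * b
  regroup = solve-∀

ι : Bool → ℕ
ι true = 1
ι false = 0

sumFin : ∀ k → (Fin k → ℕ) → ℕ
sumFin zero f = 0
sumFin (suc k) f = f zero + sumFin k (f ∘ suc)

prodFin : ∀ k → (Fin k → ℕ) → ℕ
prodFin zero f = 1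
prodFin (suc k) f = f zero * prodFin k (f ∘ suc)

sumFin-cong : ∀ k {f g : Fin k → ℕ} → (∀ j → f j ≡ g j) → sumFin k f ≡ sumFin k g
sumFin-cong zero f≡g = refl
sumFin-cong (suc k) f≡g = cong₂ _+_ (f≡g zero) (sumFin-cong k (f≡g ∘ suc))

sumFin-*ˡ : ∀ k c (f : Fin k → ℕ) → sumFin k (λ j → c * f j) ≡ c * sumFin k f
sumFin-*ˡ zero c f = sym (*-zeroʳ c)
sumFin-*ˡ (suc k) c f = trans (cong (c * f zero +_) (sumFin-*ˡ k c (f ∘ suc))) (sym (*-distribˡ-+ c _ _))

prodFin-cong : ∀ k {f g : Fin k → ℕ} → (∀ j → f j ≡ g j) → prodFin k f ≡ prodFin k g
prodFin-cong zero f≡g = refl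
prodFin-cong (suc k) f≡g = cong₂ _*_ (f≡g zero) (prodFin-cong k (f≡g ∘ suc))

prodFin-mono : ∀ k {f g : Fin k → ℕ} → (∀ j → f j ≤ g j) → prodFin k f ≤ prodFin k g
prodFin-mono zero f≤g = ≤-refl
prodFin-mono (suc k) f≤g = *-mono-≤ (f≤g zero) (prodFin-mono k (f≤g ∘ suc))

-- How a coordinate contributes to a sum over subsets: both values if it is
-- in the mask, only the value at "absent" otherwise.
merge : Bool → ℕ → ℕ → ℕ
merge true a b = a + b
merge false a b = a

merge-≥ : ∀ b x y → x ≤ merge b x y
merge-≥ true x y = m≤m+n x y
merge-≥ false x y = ≤-refl

summedOut : ∀ {n} → Bool → (Subset (suc n) → ℕ) → Subset n → ℕ
summedOut b F x = merge b (F (false ∷ x)) (F (true ∷ x))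

-- sumSub D f = ∑ over subsets x ⊆ D of f x, summing out one coordinate at a time.
sumSub : ∀ {n} → Subset n → (Subset n → ℕ) → ℕ
sumSub [] f = f []
sumSub (b ∷ D) f = sumSub D (summedOut b f)

-- One coordinate of Finner's inequality: Mahler's inequality in which some
-- factors are inactive (αⱼ = βⱼ) and just contribute αⱼ.  The active pairs
-- seen so far are collected in acc, the inactive factors in P.
mahler-partial : ∀ d .{{_ : NonZero d}} k (b : Fin k → Bool) (α β : Fin k → ℕ) →
  (∀ j → b j ≡ false → α j ≡ β j) → ∀ acc P u w →
  sumFin k (ι ∘ b) + length acc ≡ d →
  u ^ d ≤ P * α-part acc * prodFin k α → w ^ d ≤ P * β-part acc * prodFin k β →
  (u + w) ^ d ≤ P * ∏σ acc * prodFin k (λ j → merge (b j) (α j) (β j))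
mahler-partial d zero b α β inactive acc P u w refl hu hw =
  subst ((u + w) ^ length acc ≤_) (sym (*-identityʳ _))
    (mahler acc P u w (subst (u ^ length acc ≤_) (*-identityʳ _) hu) (subst (w ^ length acc ≤_) (*-identityʳ _) hw))
mahler-partial d (suc k) b α β inactive acc P u w count hu hw with b zero in b₀
... | true = subst ((u + w) ^ d ≤_) (regroup′ P (α zero + β zero) (∏σ acc) _)
  (mahler-partial d k (b ∘ suc) (α ∘ suc) (β ∘ suc) (inactive ∘ suc) ((α zero , β zero) ∷ acc) P u w
    (trans (+-suc _ _) count)
    (subst (u ^ d ≤_) (regroup P (α zero) (α-part acc) _) hu)
    (subst (w ^ d ≤_) (regroup P (β zero) (β-part acc) _) hw))
  where
  regroup : ∀ P a A R → P * A * (a * R) ≡ P * (a * A) * R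
  regroup = solve-∀
  regroup′ : ∀ P s G R → P * (s * G) * R ≡ P * G * (s * R)
  regroup′ = solve-∀
... | false = subst ((u + w) ^ d ≤_) (regroup′ P (α zero) (∏σ acc) _)
  (mahler-partial d k (b ∘ suc) (α ∘ suc) (β ∘ suc) (inactive ∘ suc) acc (P * α zero) u w count
    (subst (u ^ d ≤_) (regroup P (α zero) (α-part acc) _) hu)
    (subst (w ^ d ≤_) (trans (cong (λ c → P * β-part acc * (c * _)) (sym (inactive zero b₀))) (regroup P (α zero) (β-part acc) _)) hw))
  where
  regroup : ∀ P a A R → P * A * (a * R) ≡ P * a * A * R
  regroup = solve-∀
  regroup′ : ∀ P a G R → P * a * G * R ≡ P * G * (a * R)
  regroup′ = solve-∀

mahler-coordinate : ∀ d .{{_ : NonZero d}} k (b : Fin k → Bool) (α β : Fin k → ℕ) →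
  (∀ j → b j ≡ false → α j ≡ β j) → sumFin k (ι ∘ b) ≡ d → ∀ u w →
  u ^ d ≤ prodFin k α → w ^ d ≤ prodFin k β →
  (u + w) ^ d ≤ prodFin k (λ j → merge (b j) (α j) (β j))
mahler-coordinate d k b α β inactive count u w hu hw =
  subst ((u + w) ^ d ≤_) (*-identityˡ _)
    (mahler-partial d k b α β inactive [] 1 u w (trans (+-identityʳ _) count)
      (subst (u ^ d ≤_) (sym (*-identityˡ _)) hu) (subst (w ^ d ≤_) (sym (*-identityˡ _)) hw))

DependsOn : ∀ {n} → Subset n → (Subset n → ℕ) → Set
DependsOn M F = ∀ x y → x ∩ M ≡ y ∩ M → F x ≡ F y

-- Views of sumSub for a mask that is not syntactically a cons (resp. nil).
sumSub-head : ∀ {n} (M : Subset (suc n)) F → sumSub M F ≡ sumSub (tail M) (summedOut (head M) F)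
sumSub-head (b ∷ M) F = refl

sumSub-nil : ∀ (M : Subset 0) F → sumSub M F ≡ F []
sumSub-nil [] F = refl

DependsOn-summedOut : ∀ {n} (M : Subset (suc n)) F → DependsOn M F → DependsOn (tail M) (summedOut (head M) F)
DependsOn-summedOut (true ∷ M) F dep x y eq = cong₂ _+_ (dep _ _ (cong (false ∷_) eq)) (dep _ _ (cong (true ∷_) eq))
DependsOn-summedOut (false ∷ M) F dep x y eq = dep _ _ (cong (false ∷_) eq)

DependsOn-absent : ∀ {n} (M : Subset (suc n)) F → DependsOn M F → head M ≡ false → ∀ x → F (false ∷ x) ≡ F (true ∷ x)
DependsOn-absent (false ∷ M) F dep refl x = dep _ _ refl

coverage : ∀ {n} k → (Fin k → Subset n) → Fin n → ℕ
coverage k M v = sumFin k (λ j → ι (lookup (M j) v))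

coverage-head : ∀ {n} k (M : Fin k → Subset (suc n)) → coverage k M zero ≡ sumFin k (λ j → ι (head (M j)))
coverage-head zero M = refl
coverage-head (suc k) M = cong₂ _+_ (cong ι (lookup-zero (M zero))) (coverage-head k (M ∘ suc))
  where
  lookup-zero : ∀ {n} (S : Subset (suc n)) → lookup S zero ≡ head S
  lookup-zero (b ∷ S) = refl

coverage-tail : ∀ {n} k (M : Fin k → Subset (suc n)) v → coverage k M (suc v) ≡ coverage k (tail ∘ M) v
coverage-tail zero M v = refl
coverage-tail (suc k) M v = cong₂ _+_ (cong ι (lookup-suc (M zero))) (coverage-tail k (M ∘ suc) v)
  where
  lookup-suc : ∀ (S : Subset (suc _)) → lookup S (suc v) ≡ lookup (tail S) v
  lookup-suc (b ∷ S) = refl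

-- Coordinates are summed out one at a time, by Mahler's inequality.
finner : ∀ d .{{_ : NonZero d}} n (D : Subset n) k (M : Fin k → Subset n) (F : Fin k → Subset n → ℕ) (K : Subset n → ℕ) →
  (∀ v → lookup D v ≡ true → coverage k M v ≡ d) → (∀ j → DependsOn (M j) (F j)) →
  (∀ x → K x ^ d ≤ prodFin k (λ j → F j x)) →
  sumSub D K ^ d ≤ prodFin k (λ j → sumSub (M j) (F j))
finner d zero [] k M F K cover dep bound =
  ≤-trans (bound []) (≤-reflexive (prodFin-cong k (λ j → sym (sumSub-nil (M j) (F j)))))
finner d (suc n) (b ∷ D) k M F K cover dep bound =
  ≤-trans (finner d n D k (tail ∘ M) F′ (summedOut b K) cover′ dep′ (bound′ b (cover zero)))
          (≤-reflexive (prodFin-cong k (λ j → sym (sumSub-head (M j) (F j)))))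
  where
  F′ : Fin k → Subset n → ℕ
  F′ j = summedOut (head (M j)) (F j)
  cover′ : ∀ v → lookup D v ≡ true → coverage k (tail ∘ M) v ≡ d
  cover′ v v∈D = trans (sym (coverage-tail k M v)) (cover (suc v) v∈D)
  dep′ : ∀ j → DependsOn (tail (M j)) (F′ j)
  dep′ j = DependsOn-summedOut (M j) (F j) (dep j)
  bound′ : ∀ b → (b ≡ true → coverage k M zero ≡ d) → ∀ x → summedOut b K x ^ d ≤ prodFin k (λ j → F′ j x)
  bound′ true head-covered x =
    mahler-coordinate d k (head ∘ M) (λ j → F j (false ∷ x)) (λ j → F j (true ∷ x))
      (λ j absent → DependsOn-absent (M j) (F j) (dep j) absent x)
      (trans (sym (coverage-head k M)) (head-covered refl))
      (K (false ∷ x)) (K (true ∷ x)) (bound (false ∷ x)) (bound (true ∷ x))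
  bound′ false _ x = ≤-trans (bound (false ∷ x)) (prodFin-mono k (λ j → merge-≥ (head (M j)) _ _))

sumSub-cong : ∀ {n} (D : Subset n) {f g : Subset n → ℕ} → (∀ x → f x ≡ g x) → sumSub D f ≡ sumSub D g
sumSub-cong [] f≡g = f≡g []
sumSub-cong (b ∷ D) f≡g = sumSub-cong D (λ x → cong₂ (merge b) (f≡g (false ∷ x)) (f≡g (true ∷ x)))

sumSub-cong-⊆ : ∀ {n} (D : Subset n) {f g : Subset n → ℕ} → (∀ x → x ⊆ D → f x ≡ g x) → sumSub D f ≡ sumSub D g
sumSub-cong-⊆ [] f≡g = f≡g [] (λ ())
sumSub-cong-⊆ (true ∷ D) f≡g = sumSub-cong-⊆ D (λ x x⊆D → cong₂ _+_ (f≡g (false ∷ x) (out⊆ x⊆D)) (f≡g (true ∷ x) (s⊆s x⊆D)))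
sumSub-cong-⊆ (false ∷ D) f≡g = sumSub-cong-⊆ D (λ x x⊆D → f≡g (false ∷ x) (out⊆ x⊆D))

sumSub-mono : ∀ {n} (D : Subset n) {f g : Subset n → ℕ} → (∀ x → f x ≤ g x) → sumSub D f ≤ sumSub D g
sumSub-mono [] f≤g = f≤g []
sumSub-mono (true ∷ D) f≤g = sumSub-mono D (λ x → +-mono-≤ (f≤g (false ∷ x)) (f≤g (true ∷ x)))
sumSub-mono (false ∷ D) f≤g = sumSub-mono D (λ x → f≤g (false ∷ x))

sumSub-+ : ∀ {n} (D : Subset n) (f g : Subset n → ℕ) → sumSub D (λ x → f x + g x) ≡ sumSub D f + sumSub D g
sumSub-+ [] f g = refl
sumSub-+ (true ∷ D) f g = trans (sumSub-cong D (λ x → interchange (f (false ∷ x)) (g (false ∷ x)) (f (true ∷ x)) (g (true ∷ x))))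
  (sumSub-+ D (λ x → f (false ∷ x) + f (true ∷ x)) (λ x → g (false ∷ x) + g (true ∷ x)))
  where
  interchange : ∀ a b c e → a + b + (c + e) ≡ a + c + (b + e)
  interchange = solve-∀
sumSub-+ (false ∷ D) f g = sumSub-+ D (λ x → f (false ∷ x)) (λ x → g (false ∷ x))

sumSub-*ˡ : ∀ {n} (D : Subset n) c (f : Subset n → ℕ) → sumSub D (λ x → c * f x) ≡ c * sumSub D f
sumSub-*ˡ [] c f = refl
sumSub-*ˡ (true ∷ D) c f = trans (sumSub-cong D (λ x → sym (*-distribˡ-+ c (f (false ∷ x)) (f (true ∷ x)))))
  (sumSub-*ˡ D c (λ x → f (false ∷ x) + f (true ∷ x)))
sumSub-*ˡ (false ∷ D) c f = sumSub-*ˡ D c (λ x → f (false ∷ x))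

sumSub-*ʳ : ∀ {n} (D : Subset n) c (f : Subset n → ℕ) → sumSub D (λ x → f x * c) ≡ sumSub D f * c
sumSub-*ʳ D c f = trans (sumSub-cong D (λ x → *-comm (f x) c)) (trans (sumSub-*ˡ D c f) (*-comm c _))

sumSub-const : ∀ {n} (D : Subset n) c → sumSub D (λ _ → c) ≡ 2 ^ ∣ D ∣ * c
sumSub-const [] c = sym (+-identityʳ c)
sumSub-const (true ∷ D) c = trans (sumSub-const D (c + c)) (double (2 ^ ∣ D ∣) c)
  where
  double : ∀ a c → a * (c + c) ≡ (a + (a + 0)) * c
  double = solve-∀
sumSub-const (false ∷ D) c = sumSub-const D c

sumSub-⊥ : ∀ n (f : Subset n → ℕ) → sumSub ⊥ f ≡ f ⊥
sumSub-⊥ zero f = refl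
sumSub-⊥ (suc n) f = sumSub-⊥ n (λ x → f (false ∷ x))

sumSub-∪ : ∀ {n} (D₁ D₂ : Subset n) → D₁ ∩ D₂ ≡ ⊥ → (f : Subset n → ℕ) →
  sumSub (D₁ ∪ D₂) f ≡ sumSub D₁ (λ y → sumSub D₂ (λ z → f (y ∪ z)))
sumSub-∪ [] [] _ f = refl
sumSub-∪ (true ∷ D₁) (false ∷ D₂) disj f =
  trans (sumSub-∪ D₁ D₂ (∷-injectiveʳ disj) (λ x → f (false ∷ x) + f (true ∷ x)))
        (sumSub-cong D₁ (λ y → sumSub-+ D₂ (λ z → f (false ∷ (y ∪ z))) (λ z → f (true ∷ (y ∪ z)))))
sumSub-∪ (false ∷ D₁) (true ∷ D₂) disj f = sumSub-∪ D₁ D₂ (∷-injectiveʳ disj) (λ x → f (false ∷ x) + f (true ∷ x))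
sumSub-∪ (false ∷ D₁) (false ∷ D₂) disj f = sumSub-∪ D₁ D₂ (∷-injectiveʳ disj) (λ x → f (false ∷ x))

sumSub-sumFin : ∀ {n} (D : Subset n) k (h : Fin k → Subset n → ℕ) →
  sumSub D (λ e → sumFin k (λ a → h a e)) ≡ sumFin k (λ a → sumSub D (h a))
sumSub-sumFin D zero h = trans (sumSub-const D 0) (*-zeroʳ (2 ^ ∣ D ∣))
sumSub-sumFin D (suc k) h = trans (sumSub-+ D (h zero) (λ e → sumFin k (λ a → h (suc a) e)))
  (cong (sumSub D (h zero) +_) (sumSub-sumFin D k (h ∘ suc)))

sum-allSubsets : ∀ n (g : Subset n → ℕ) → sum (map g (allSubsets n)) ≡ sumSub ⊤ g
sum-allSubsets zero g = +-identityʳ (g [])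
sum-allSubsets (suc n) g = begin
  sum (map g (map (false ∷_) xs ++ map (true ∷_) xs))
    ≡⟨ cong sum (map-++ g (map (false ∷_) xs) (map (true ∷_) xs)) ⟩
  sum (map g (map (false ∷_) xs) ++ map g (map (true ∷_) xs))
    ≡⟨ sum-++ (map g (map (false ∷_) xs)) (map g (map (true ∷_) xs)) ⟩
  sum (map g (map (false ∷_) xs)) + sum (map g (map (true ∷_) xs))
    ≡⟨ cong₂ _+_ (cong sum (sym (map-∘ xs))) (cong sum (sym (map-∘ xs))) ⟩
  sum (map (g ∘ (false ∷_)) xs) + sum (map (g ∘ (true ∷_)) xs)
    ≡⟨ cong₂ _+_ (sum-allSubsets n (g ∘ (false ∷_))) (sum-allSubsets n (g ∘ (true ∷_))) ⟩
  sumSub ⊤ (g ∘ (false ∷_)) + sumSub ⊤ (g ∘ (true ∷_))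
    ≡⟨ sym (sumSub-+ ⊤ (g ∘ (false ∷_)) (g ∘ (true ∷_))) ⟩
  sumSub ⊤ (λ x → g (false ∷ x) + g (true ∷ x)) ∎
  where
  open ≡-Reasoning
  xs = allSubsets n

length-filter : ∀ {A : Set} (p : A → Bool) xs → length (filterᵇ p xs) ≡ sum (map (ι ∘ p) xs)
length-filter p [] = refl
length-filter p (x ∷ xs) with p x
... | true = cong suc (length-filter p xs)
... | false = length-filter p xs

sum-filter : ∀ {A : Set} (p : A → Bool) (f : A → ℕ) xs →
  sum (map f (filterᵇ p xs)) ≡ sum (map (λ x → ι (p x) * f x) xs)
sum-filter p f [] = refl
sum-filter p f (x ∷ xs) with p x
... | true = cong₂ _+_ (sym (+-identityʳ (f x))) (sum-filter p f xs)
... | false = sum-filter p f xs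

count-allSubsets : ∀ n (p : Subset n → Bool) → length (filterᵇ p (allSubsets n)) ≡ sumSub ⊤ (ι ∘ p)
count-allSubsets n p = trans (length-filter p (allSubsets n)) (sum-allSubsets n (ι ∘ p))

ι-∧ : ∀ a b → ι (a ∧ b) ≡ ι a * ι b
ι-∧ true b = sym (+-identityʳ (ι b))
ι-∧ false b = refl

ι-not : ∀ b → ι b + ι (not b) ≡ 1
ι-not true = refl
ι-not false = refl

ι-not-∨ : ∀ a b → ι (not (a ∨ b)) ≡ ι (not a) * ι (not b)
ι-not-∨ true b = refl
ι-not-∨ false b = sym (+-identityʳ _)

ι-∨-disjoint : ∀ a b → a ∧ b ≡ false → ι (a ∨ b) ≡ ι a + ι b
ι-∨-disjoint true false _ = refl
ι-∨-disjoint false b _ = refl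

∣∣-sumFin : ∀ {n} (p : Subset n) → ∣ p ∣ ≡ sumFin n (λ a → ι (lookup p a))
∣∣-sumFin [] = refl
∣∣-sumFin (true ∷ p) = cong suc (∣∣-sumFin p)
∣∣-sumFin (false ∷ p) = ∣∣-sumFin p

infix 5 _⊆ᵇ_
_⊆ᵇ_ : ∀ {n} → Subset n → Subset n → Bool
[] ⊆ᵇ [] = true
(b ∷ p) ⊆ᵇ (c ∷ q) = (not b ∨ c) ∧ (p ⊆ᵇ q)

⊆ᵇ-sound : ∀ {n} (p q : Subset n) → p ⊆ᵇ q ≡ true → p ⊆ q
⊆ᵇ-sound [] [] _ ()
⊆ᵇ-sound (false ∷ p) (c ∷ q) p⊆q = out⊆ (⊆ᵇ-sound p q p⊆q)
⊆ᵇ-sound (true ∷ p) (true ∷ q) p⊆q = s⊆s (⊆ᵇ-sound p q p⊆q)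

⊆ᵇ-complete : ∀ {n} (p q : Subset n) → p ⊆ q → p ⊆ᵇ q ≡ true
⊆ᵇ-complete [] [] _ = refl
⊆ᵇ-complete (false ∷ p) (c ∷ q) p⊆q = ⊆ᵇ-complete p q (drop-∷-⊆ p⊆q)
⊆ᵇ-complete (true ∷ p) (c ∷ q) p⊆q with p⊆q Vec.here
... | Vec.here = ⊆ᵇ-complete p q (drop-∷-⊆ p⊆q)

⌊⊆?⌋≡⊆ᵇ : ∀ {n} (p q : Subset n) → ⌊ p ⊆? q ⌋ ≡ p ⊆ᵇ q
⌊⊆?⌋≡⊆ᵇ p q with p ⊆? q | p ⊆ᵇ q in eq
... | yes p⊆q | _ = sym (trans (sym eq) (⊆ᵇ-complete p q p⊆q))
... | no p⊈q | true = contradiction (λ {x} → ⊆ᵇ-sound p q eq {x}) p⊈q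
... | no p⊈q | false = refl

sumSub-⊆ᵇ : ∀ {n} (A S : Subset n) → sumSub A (λ z → ι (z ⊆ᵇ S)) ≡ prodFin n (λ a → merge (lookup A a) 1 (ι (lookup S a)))
sumSub-⊆ᵇ [] [] = refl
sumSub-⊆ᵇ (b ∷ A) (s ∷ S) = begin
  sumSub A (λ z → merge b (ι (z ⊆ᵇ S)) (ι (s ∧ (z ⊆ᵇ S))))   ≡⟨ sumSub-cong A (λ z → factor b s (z ⊆ᵇ S)) ⟩
  sumSub A (λ z → merge b 1 (ι s) * ι (z ⊆ᵇ S))            ≡⟨ sumSub-*ˡ A (merge b 1 (ι s)) _ ⟩
  merge b 1 (ι s) * sumSub A (λ z → ι (z ⊆ᵇ S))            ≡⟨ cong (merge b 1 (ι s) *_) (sumSub-⊆ᵇ A S) ⟩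
  merge b 1 (ι s) * prodFin _ (λ a → merge (lookup A a) 1 (ι (lookup S a))) ∎
  where
  open ≡-Reasoning
  factor : ∀ b s x → merge b (ι x) (ι (s ∧ x)) ≡ merge b 1 (ι s) * ι x
  factor true true x = cong (ι x +_) (sym (+-identityʳ (ι x)))
  factor true false x = refl
  factor false s x = sym (*-identityˡ (ι x))

count-⊇-self : ∀ {n} (T : Subset n) → sumSub T (λ y → ι (T ⊆ᵇ y)) ≡ 1
count-⊇-self [] = refl
count-⊇-self (true ∷ T) = count-⊇-self T
count-⊇-self (false ∷ T) = count-⊇-self T

count-⊉-self : ∀ {n} (T : Subset n) → sumSub T (λ y → ι (not (T ⊆ᵇ y))) ≡ 2 ^ ∣ T ∣ ∸ 1
count-⊉-self T = begin
  X                                                  ≡⟨ sym (m+n∸m≡n 1 X) ⟩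
  1 + X ∸ 1                                          ≡⟨ cong (λ t → t + X ∸ 1) (sym (count-⊇-self T)) ⟩
  sumSub T (λ y → ι (T ⊆ᵇ y)) + X ∸ 1                ≡⟨ cong (_∸ 1) (sym (sumSub-+ T _ _)) ⟩
  sumSub T (λ y → ι (T ⊆ᵇ y) + ι (not (T ⊆ᵇ y))) ∸ 1 ≡⟨ cong (_∸ 1) (sumSub-cong T (λ y → ι-not (T ⊆ᵇ y))) ⟩
  sumSub T (λ _ → 1) ∸ 1                             ≡⟨ cong (_∸ 1) (trans (sumSub-const T 1) (*-identityʳ (2 ^ ∣ T ∣))) ⟩
  2 ^ ∣ T ∣ ∸ 1                                      ∎
  where
  open ≡-Reasoning
  X = sumSub T (λ y → ι (not (T ⊆ᵇ y)))

⊆ᵇ-∪-disjoint : ∀ {n} (S y z : Subset n) → S ∩ z ≡ ⊥ → S ⊆ᵇ y ∪ z ≡ S ⊆ᵇ y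
⊆ᵇ-∪-disjoint [] [] [] _ = refl
⊆ᵇ-∪-disjoint (true ∷ S) (true ∷ y) (false ∷ z) disj = ⊆ᵇ-∪-disjoint S y z (∷-injectiveʳ disj)
⊆ᵇ-∪-disjoint (true ∷ S) (false ∷ y) (false ∷ z) disj = refl
⊆ᵇ-∪-disjoint (false ∷ S) (b ∷ y) (c ∷ z) disj = ⊆ᵇ-∪-disjoint S y z (∷-injectiveʳ disj)

⊆ᵇ-local : ∀ {n} (T N x y : Subset n) → T ⊆ N → x ∩ N ≡ y ∩ N → T ⊆ᵇ x ≡ T ⊆ᵇ y
⊆ᵇ-local [] [] [] [] _ _ = refl
⊆ᵇ-local (false ∷ T) (m ∷ N) (b ∷ x) (c ∷ y) T⊆N eq = ⊆ᵇ-local T N x y (drop-∷-⊆ T⊆N) (∷-injectiveʳ eq)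
⊆ᵇ-local (true ∷ T) (m ∷ N) (b ∷ x) (c ∷ y) T⊆N eq with T⊆N Vec.here
... | Vec.here = cong₂ _∧_ (head-equal b c eq) (⊆ᵇ-local T N x y (drop-∷-⊆ T⊆N) (∷-injectiveʳ eq))
  where
  head-equal : ∀ b c {xs ys : Subset _} → (b ∧ true) ∷ xs ≡ (c ∧ true) ∷ ys → b ≡ c
  head-equal true true _ = refl
  head-equal false false _ = refl
  head-equal true false ()
  head-equal false true ()

Disjoint : ∀ {n} → Subset n → Subset n → Set
Disjoint S T = S ∩ T ≡ ⊥

disjoint-⊆ : ∀ {n} {S S′ T T′ : Subset n} → S ⊆ S′ → T ⊆ T′ → Disjoint S′ T′ → Disjoint S T
disjoint-⊆ {S = S} {T = T} S⊆S′ T⊆T′ disj = Empty-unique λ (x , x∈S∩T) →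
  let (x∈S , x∈T) = x∈p∩q⁻ S T x∈S∩T in ∉⊥ (subst (x ∈_) disj (x∈p∩q⁺ (S⊆S′ x∈S , T⊆T′ x∈T)))

disjoint-⋃ : ∀ {n} (T : Subset n) Ts → All (Disjoint T) Ts → Disjoint T (⋃ Ts)
disjoint-⋃ T [] [] = ∩-zeroʳ T
disjoint-⋃ T (U ∷ Us) (T∩U ∷ T∩Us) = begin
  T ∩ (U ∪ ⋃ Us)         ≡⟨ ∩-distribˡ-∪ T U (⋃ Us) ⟩
  T ∩ U ∪ T ∩ ⋃ Us       ≡⟨ cong₂ _∪_ T∩U (disjoint-⋃ T Us T∩Us) ⟩
  ⊥ ∪ ⊥                  ≡⟨ ∪-identityˡ ⊥ ⟩
  ⊥                      ∎
  where open ≡-Reasoning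

⊆-⋃ : ∀ {n} {T : Subset n} Ts → T ∈ₗ Ts → T ⊆ ⋃ Ts
⊆-⋃ (T ∷ Ts) (here refl) = p⊆p∪q (⋃ Ts)
⊆-⋃ (U ∷ Ts) (there T∈Ts) = ⊆-trans (⊆-⋃ Ts T∈Ts) (q⊆p∪q U (⋃ Ts))

∣∪∣-disjoint : ∀ {n} (S T : Subset n) → Disjoint S T → ∣ S ∪ T ∣ ≡ ∣ S ∣ + ∣ T ∣
∣∪∣-disjoint [] [] _ = refl
∣∪∣-disjoint (true ∷ S) (false ∷ T) disj = cong suc (∣∪∣-disjoint S T (∷-injectiveʳ disj))
∣∪∣-disjoint (false ∷ S) (true ∷ T) disj = trans (cong suc (∣∪∣-disjoint S T (∷-injectiveʳ disj))) (sym (+-suc _ _))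
∣∪∣-disjoint (false ∷ S) (false ∷ T) disj = ∣∪∣-disjoint S T (∷-injectiveʳ disj)

∣⋃∣-disjoint : ∀ {n} (Ts : List (Subset n)) → AllPairs Disjoint Ts → ∣ ⋃ Ts ∣ ≡ sum (map ∣_∣ Ts)
∣⋃∣-disjoint {n} [] [] = ∣⊥∣≡0 n
∣⋃∣-disjoint (T ∷ Ts) (T∩Ts ∷ disj) =
  trans (∣∪∣-disjoint T (⋃ Ts) (disjoint-⋃ T Ts T∩Ts)) (cong (∣ T ∣ +_) (∣⋃∣-disjoint Ts disj))

-- A point lies in at most one member of a disjoint family.
ι-⋃-disjoint : ∀ {n} (Ts : List (Subset n)) → AllPairs Disjoint Ts → ∀ v →
  ι (lookup (⋃ Ts) v) ≡ sum (map (λ T → ι (lookup T v)) Ts)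
ι-⋃-disjoint [] [] v = cong ι (lookup-replicate v false)
ι-⋃-disjoint (T ∷ Ts) (T∩Ts ∷ disj) v = begin
  ι (lookup (T ∪ ⋃ Ts) v)                        ≡⟨ cong ι (lookup-zipWith _∨_ v T (⋃ Ts)) ⟩
  ι (lookup T v ∨ lookup (⋃ Ts) v)               ≡⟨ ι-∨-disjoint (lookup T v) (lookup (⋃ Ts) v) apart ⟩
  ι (lookup T v) + ι (lookup (⋃ Ts) v)           ≡⟨ cong (ι (lookup T v) +_) (ι-⋃-disjoint Ts disj v) ⟩
  ι (lookup T v) + sum (map (λ T → ι (lookup T v)) Ts) ∎
  where
  open ≡-Reasoning
  apart : lookup T v ∧ lookup (⋃ Ts) v ≡ false
  apart = trans (sym (lookup-zipWith _∧_ v T (⋃ Ts)))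
                (trans (cong (λ S → lookup S v) (disjoint-⋃ T Ts T∩Ts)) (lookup-replicate v false))

any-cong : ∀ {A : Set} {p q : A → Bool} {xs} → All (λ x → p x ≡ q x) xs → any p xs ≡ any q xs
any-cong [] = refl
any-cong (px≡qx ∷ eqs) = cong₂ _∨_ px≡qx (any-cong eqs)

-- For a pairwise disjoint family Ts, the subsets of ⋃ Ts containing no member
-- of Ts number ∏_{T ∈ Ts} (2^|T| − 1): choose a proper subset of each member.
count-avoiding : ∀ {n} (Ts : List (Subset n)) → AllPairs Disjoint Ts →
  sumSub (⋃ Ts) (λ y → ι (not (any (_⊆ᵇ y) Ts))) ≡ product (map (λ T → 2 ^ ∣ T ∣ ∸ 1) Ts)
count-avoiding {n} [] [] = sumSub-⊥ n _
count-avoiding (T ∷ Ts) (T∩Ts ∷ disj) = begin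
  sumSub (T ∪ U) (λ x → ι (not (any (_⊆ᵇ x) (T ∷ Ts))))
    ≡⟨ sumSub-∪ T U T∩U _ ⟩
  sumSub T (λ y → sumSub U (λ z → ι (not ((T ⊆ᵇ y ∪ z) ∨ any (_⊆ᵇ y ∪ z) Ts))))
    ≡⟨ sumSub-cong-⊆ T (λ y y⊆T → sumSub-cong-⊆ U (λ z z⊆U → separate y z y⊆T z⊆U)) ⟩
  sumSub T (λ y → sumSub U (λ z → ι (not (T ⊆ᵇ y)) * ι (not (any (_⊆ᵇ z) Ts))))
    ≡⟨ sumSub-cong T (λ y → sumSub-*ˡ U (ι (not (T ⊆ᵇ y))) _) ⟩
  sumSub T (λ y → ι (not (T ⊆ᵇ y)) * sumSub U (λ z → ι (not (any (_⊆ᵇ z) Ts))))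
    ≡⟨ sumSub-*ʳ T _ _ ⟩
  sumSub T (λ y → ι (not (T ⊆ᵇ y))) * sumSub U (λ z → ι (not (any (_⊆ᵇ z) Ts)))
    ≡⟨ cong₂ _*_ (count-⊉-self T) (count-avoiding Ts disj) ⟩
  (2 ^ ∣ T ∣ ∸ 1) * product (map (λ T → 2 ^ ∣ T ∣ ∸ 1) Ts) ∎
  where
  open ≡-Reasoning
  U = ⋃ Ts
  T∩U : Disjoint T U
  T∩U = disjoint-⋃ T Ts T∩Ts
  separate : ∀ y z → y ⊆ T → z ⊆ U →
    ι (not ((T ⊆ᵇ y ∪ z) ∨ any (_⊆ᵇ y ∪ z) Ts)) ≡ ι (not (T ⊆ᵇ y)) * ι (not (any (_⊆ᵇ z) Ts))
  separate y z y⊆T z⊆U = trans (ι-not-∨ (T ⊆ᵇ y ∪ z) _)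
    (cong₂ (λ s t → ι (not s) * ι (not t))
      (⊆ᵇ-∪-disjoint T y z (disjoint-⊆ (λ x → x) z⊆U T∩U))
      (any-cong (All.tabulate λ {T′} T′∈Ts →
        trans (cong (T′ ⊆ᵇ_) (∪-comm y z))
              (⊆ᵇ-∪-disjoint T′ z y (disjoint-⊆ (⊆-⋃ Ts T′∈Ts) y⊆T (trans (∩-comm U T) T∩U))))))

⌊∈?⌋≡lookup : ∀ {n} (v : Fin n) (e : Subset n) → ⌊ v ∈? e ⌋ ≡ lookup e v
⌊∈?⌋≡lookup v e with v ∈? e | lookup e v in eq
... | yes v∈e | _ = sym (trans (sym eq) ([]=⇒lookup v∈e))
... | no v∉e | true = contradiction (lookup⇒[]= v e eq) v∉e
... | no v∉e | false = refl

∈-allSubsets : ∀ n (e : Subset n) → e ∈ₗ allSubsets n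
∈-allSubsets zero [] = here refl
∈-allSubsets (suc n) (false ∷ e) = ∈-++⁺ˡ (∈-map⁺ (false ∷_) (∈-allSubsets n e))
∈-allSubsets (suc n) (true ∷ e) = ∈-++⁺ʳ (map (false ∷_) (allSubsets n)) (∈-map⁺ (true ∷_) (∈-allSubsets n e))

unique-allSubsets : ∀ n → Unique (allSubsets n)
unique-allSubsets zero = [] ∷ []
unique-allSubsets (suc n) =
  Unique.++⁺ (Unique.map⁺ ∷-injectiveʳ (unique-allSubsets n)) (Unique.map⁺ ∷-injectiveʳ (unique-allSubsets n)) halves-disjoint
  where
  halves-disjoint : ∀ {v} → ¬ (v ∈ₗ map (false ∷_) (allSubsets n) × v ∈ₗ map (true ∷_) (allSubsets n))
  halves-disjoint (in-false , in-true) with ∈-map⁻ (false ∷_) in-false | ∈-map⁻ (true ∷_) in-true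
  ... | _ , _ , refl | _ , _ , ()

module HypergraphFacts {n : ℕ} (G : Hypergraph n) where

  incident : Fin n → Subset n → Bool
  incident a e = G e ∧ ⌊ a ∈? e ⌋

  edgesAt : Fin n → List (Subset n)
  edgesAt a = filterᵇ (incident a) (allSubsets n)

  edgesAt⁻ : ∀ {a e} → e ∈ₗ edgesAt a → IsEdge G e × a ∈ e
  edgesAt⁻ {a} {e} e∈ with Equivalence.to T-∧ (proj₂ (∈-filter⁻ (T? ∘ incident a) {xs = allSubsets n} e∈))
  ... | edge , a∈e = Equivalence.to T-≡ edge , lookup⇒[]= a e (trans (sym (⌊∈?⌋≡lookup a e)) (Equivalence.to T-≡ a∈e))

  unique-edgesAt : ∀ a → Unique (edgesAt a)
  unique-edgesAt a = Unique.filter⁺ (T? ∘ incident a) (unique-allSubsets n)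

  links : Fin n → List (Subset n)
  links a = map (_- a) (edgesAt a)

  nbhd : Fin n → Subset n
  nbhd a = ⋃ (links a)

  -- y contains no link edge of a, so a can be added to y without creating an edge.
  free : Fin n → Subset n → Bool
  free a y = not (any (_⊆ᵇ y) (links a))

  lookup-─ : ∀ (e : Subset n) {a v} → v ≢ a → lookup (e - a) v ≡ lookup e v
  lookup-─ e {a} {v} v≢a with lookup e v in v∈e | lookup (e - a) v in v∈e-a
  ... | true | true = refl
  ... | false | false = refl
  ... | true | false = contradiction (trans (sym ([]=⇒lookup (x∈p∧x≢y⇒x∈p-y (lookup⇒[]= v e v∈e) v≢a))) v∈e-a) λ ()
  ... | false | true = contradiction (trans (sym ([]=⇒lookup (p─q⊆p e ⁅ a ⁆ (lookup⇒[]= v (e - a) v∈e-a)))) v∈e) λ ()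

  free-local : ∀ a x y → x ∩ nbhd a ≡ y ∩ nbhd a → free a x ≡ free a y
  free-local a x y eq = cong not (any-cong (All.tabulate λ {T} T∈ →
    ⊆ᵇ-local T (nbhd a) x y (⊆-⋃ (links a) T∈) eq))

  -- In an independent set y ∪ z, every vertex of z is free with respect to y:
  -- a link edge e − a ⊆ y of a ∈ z would give the edge e ⊆ y ∪ z.
  independent⇒free : ∀ y z a → isIndependent G (y ∪ z) ≡ true → a ∈ z → free a y ≡ true
  independent⇒free y z a independent a∈z with any (_⊆ᵇ y) (links a) in blocked
  ... | false = refl
  ... | true with find (any⁻ (_⊆ᵇ y) (links a) (Equivalence.from T-≡ blocked))
  ... | T , T∈links , T⊆y with ∈-map⁻ (_- a) T∈links
  ... | e , e∈edgesAt , refl = contradiction (trans (sym independent) (cong not contains-edge)) λ ()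
    where
    e⊆y∪z : e ⊆ y ∪ z
    e⊆y∪z {x} x∈e with x ≟ᶠ a
    ... | yes refl = q⊆p∪q y z a∈z
    ... | no x≢a = p⊆p∪q z (⊆ᵇ-sound (e - a) y (Equivalence.to T-≡ T⊆y) (x∈p∧x≢y⇒x∈p-y x∈e x≢a))
    contains-edge : any (λ f → G f ∧ ⌊ f ⊆? y ∪ z ⌋) (allSubsets n) ≡ true
    contains-edge = Equivalence.to T-≡ (any⁺ _ (lose (∈-allSubsets n e) (Equivalence.from T-∧
      ( Equivalence.from T-≡ (proj₁ (edgesAt⁻ e∈edgesAt))
      , Equivalence.from T-≡ (trans (⌊⊆?⌋≡⊆ᵇ e (y ∪ z)) (⊆ᵇ-complete e (y ∪ z) e⊆y∪z))))))

  ind-split : ∀ A → ind G ≡ sumSub (∁ A) (λ y → sumSub A (λ z → ι (isIndependent G (y ∪ z))))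
  ind-split A = begin
    ind G                                     ≡⟨ count-allSubsets n (isIndependent G) ⟩
    sumSub ⊤ (ι ∘ isIndependent G)            ≡⟨ cong (λ D → sumSub D (ι ∘ isIndependent G)) ∁A∪A≡⊤ ⟩
    sumSub (∁ A ∪ A) (ι ∘ isIndependent G)    ≡⟨ sumSub-∪ (∁ A) A (∁-disjoint A) _ ⟩
    sumSub (∁ A) (λ y → sumSub A (λ z → ι (isIndependent G (y ∪ z)))) ∎
    where
    open ≡-Reasoning
    ∁A∪A≡⊤ : ⊤ ≡ ∁ A ∪ A
    ∁A∪A≡⊤ = sym (trans (∪-comm (∁ A) A) (p∪∁p≡⊤ A))
    ∁-disjoint : ∀ {m} (S : Subset m) → Disjoint (∁ S) S
    ∁-disjoint [] = refl
    ∁-disjoint (true ∷ S) = cong (false ∷_) (∁-disjoint S)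
    ∁-disjoint (false ∷ S) = cong (false ∷_) (∁-disjoint S)

  -- Given y, the independent extensions y ∪ z with z ⊆ A are at most
  -- ∏_{a ∈ A} (1 + [a free for y]): z may only contain free vertices.
  extensions-bound : ∀ A y →
    sumSub A (λ z → ι (isIndependent G (y ∪ z))) ≤ prodFin n (λ a → merge (lookup A a) 1 (ι (free a y)))
  extensions-bound A y = begin
    sumSub A (λ z → ι (isIndependent G (y ∪ z)))  ≤⟨ sumSub-mono A (λ z → ι-mono (only-free z)) ⟩
    sumSub A (λ z → ι (z ⊆ᵇ freeSet))            ≡⟨ sumSub-⊆ᵇ A freeSet ⟩
    prodFin n (λ a → merge (lookup A a) 1 (ι (lookup freeSet a)))
      ≡⟨ prodFin-cong n (λ a → cong (λ b → merge (lookup A a) 1 (ι b)) (lookup∘tabulate (λ a → free a y) a)) ⟩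
    prodFin n (λ a → merge (lookup A a) 1 (ι (free a y))) ∎
    where
    open ≤-Reasoning
    freeSet : Subset n
    freeSet = tabulate (λ a → free a y)
    only-free : ∀ z → isIndependent G (y ∪ z) ≡ true → z ⊆ᵇ freeSet ≡ true
    only-free z independent = ⊆ᵇ-complete z freeSet λ {a} a∈z →
      lookup⇒[]= a freeSet (trans (lookup∘tabulate _ a) (independent⇒free y z a independent a∈z))
    ι-mono : ∀ {b c} → (b ≡ true → c ≡ true) → ι b ≤ ι c
    ι-mono {false} _ = z≤n
    ι-mono {true} b⇒c rewrite b⇒c refl = ≤-refl

  degree-sum : ∀ v → degree G v ≡ sumSub ⊤ (λ e → ι (G e) * ι (lookup e v))
  degree-sum v = trans (count-allSubsets n (incident v))
    (sumSub-cong ⊤ (λ e → trans (ι-∧ (G e) _) (cong (λ b → ι (G e) * ι b) (⌊∈?⌋≡lookup v e))))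

  edges-through-both : ∀ a v → v ≢ a →
    sumSub ⊤ (λ e → ι (G e) * ι (lookup e v) * ι (lookup e a)) ≡ sum (map (λ T → ι (lookup T v)) (links a))
  edges-through-both a v v≢a = begin
    sumSub ⊤ (λ e → ι (G e) * ι (lookup e v) * ι (lookup e a))
      ≡⟨ sumSub-cong ⊤ (λ e → trans (swap (ι (G e)) _ _) (cong (_* ι (lookup e v)) (sym (incidence e)))) ⟩
    sumSub ⊤ (λ e → ι (incident a e) * ι (lookup e v))
      ≡⟨ sym (sum-allSubsets n _) ⟩
    sum (map (λ e → ι (incident a e) * ι (lookup e v)) (allSubsets n))
      ≡⟨ sym (sum-filter (incident a) (λ e → ι (lookup e v)) (allSubsets n)) ⟩
    sum (map (λ e → ι (lookup e v)) (edgesAt a))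
      ≡⟨ cong sum (map-cong (λ e → cong ι (sym (lookup-─ e v≢a))) (edgesAt a)) ⟩
    sum (map (λ e → ι (lookup (e - a) v)) (edgesAt a))
      ≡⟨ cong sum (map-∘ (edgesAt a)) ⟩
    sum (map (λ T → ι (lookup T v)) (links a)) ∎
    where
    open ≡-Reasoning
    swap : ∀ x y z → x * y * z ≡ x * z * y
    swap x y z = trans (*-assoc x y z) (trans (cong (x *_) (*-comm y z)) (sym (*-assoc x z y)))
    incidence : ∀ e → ι (incident a e) ≡ ι (G e) * ι (lookup e a)
    incidence e = trans (ι-∧ (G e) _) (cong (λ b → ι (G e) * ι b) (⌊∈?⌋≡lookup a e))

double-count : ∀ {n} (S : Subset n) (w : Subset n → ℕ) →
  sumFin n (λ a → ι (lookup S a) * sumSub ⊤ (λ e → w e * ι (lookup e a))) ≡ sumSub ⊤ (λ e → w e * ∣ e ∩ S ∣)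
double-count {n} S w = begin
  sumFin n (λ a → ι (lookup S a) * sumSub ⊤ (λ e → w e * ι (lookup e a)))
    ≡⟨ sumFin-cong n (λ a → trans (sym (sumSub-*ˡ (⊤ {n}) (ι (lookup S a)) (λ e → w e * ι (lookup e a)))) (sumSub-cong ⊤ (λ e → incidence e a))) ⟩
  sumFin n (λ a → sumSub ⊤ (λ e → w e * ι (lookup (e ∩ S) a)))
    ≡⟨ sym (sumSub-sumFin ⊤ n (λ a e → w e * ι (lookup (e ∩ S) a))) ⟩
  sumSub ⊤ (λ e → sumFin n (λ a → w e * ι (lookup (e ∩ S) a)))
    ≡⟨ sumSub-cong ⊤ (λ e → trans (sumFin-*ˡ n (w e) _) (cong (w e *_) (sym (∣∣-sumFin (e ∩ S))))) ⟩
  sumSub ⊤ (λ e → w e * ∣ e ∩ S ∣) ∎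
  where
  open ≡-Reasoning
  incidence : ∀ e a → ι (lookup S a) * (w e * ι (lookup e a)) ≡ w e * ι (lookup (e ∩ S) a)
  incidence e a = begin
    ι (lookup S a) * (w e * ι (lookup e a))   ≡⟨ rearrange (ι (lookup S a)) (w e) (ι (lookup e a)) ⟩
    w e * (ι (lookup e a) * ι (lookup S a))   ≡⟨ cong (w e *_) (sym (ι-∧ (lookup e a) (lookup S a))) ⟩
    w e * ι (lookup e a ∧ lookup S a)         ≡⟨ cong (λ b → w e * ι b) (sym (lookup-zipWith _∧_ a e S)) ⟩
    w e * ι (lookup (e ∩ S) a)                ∎
    where
    rearrange : ∀ s w x → s * (w * x) ≡ w * (x * s)
    rearrange s w x = trans (*-comm s (w * x)) (*-assoc w x s)

suc∣p-x∣≡∣p∣ : ∀ {n} (p : Subset n) {x} → x ∈ p → suc ∣ p - x ∣ ≡ ∣ p ∣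
suc∣p-x∣≡∣p∣ (true ∷ p) Vec.here = cong (suc ∘ ∣_∣) (p─⊥≡p p)
suc∣p-x∣≡∣p∣ (true ∷ p) (Vec.there x∈p) = cong suc (suc∣p-x∣≡∣p∣ p x∈p)
suc∣p-x∣≡∣p∣ (false ∷ p) (Vec.there x∈p) = suc∣p-x∣≡∣p∣ p x∈p

allPairs-members : ∀ {A : Set} {P : A → Set} {R S : A → A → Set} {xs} →
  All P xs → AllPairs R xs → (∀ {x y} → P x → P y → R x y → S x y) → AllPairs S xs
allPairs-members [] [] h = []
allPairs-members (px ∷ pxs) (rx ∷ rxs) h =
  All.zipWith (λ (py , r) → h px py r) (pxs , rx) ∷ allPairs-members pxs rxs h

sum-const : ∀ {A : Set} (f : A → ℕ) c {xs} → All (λ x → f x ≡ c) xs → sum (map f xs) ≡ length xs * c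
sum-const f c [] = refl
sum-const f c (fx≡c ∷ eqs) = cong₂ _+_ fx≡c (sum-const f c eqs)

product-const : ∀ {A : Set} (f : A → ℕ) c {xs} → All (λ x → f x ≡ c) xs → product (map f xs) ≡ c ^ length xs
product-const f c [] = refl
product-const f c (fx≡c ∷ eqs) = cong₂ _*_ fx≡c (product-const f c eqs)

prodFin-^ : ∀ k (f : Fin k → ℕ) d → prodFin k f ^ d ≡ prodFin k (λ j → f j ^ d)
prodFin-^ zero f d = ^-zeroˡ d
prodFin-^ (suc k) f d = trans (^-distribʳ-* (f zero) _ d) (cong (f zero ^ d *_) (prodFin-^ k (f ∘ suc) d))

prodFin-indicator : ∀ {n} (A : Subset n) X → prodFin n (λ a → if lookup A a then X else 1) ≡ X ^ ∣ A ∣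
prodFin-indicator [] X = refl
prodFin-indicator (true ∷ A) X = cong (X *_) (prodFin-indicator A X)
prodFin-indicator (false ∷ A) X = trans (*-identityˡ _) (prodFin-indicator A X)

∣∣-weighted : ∀ {n} (S : Subset n) c → sumFin n (λ a → ι (lookup S a) * c) ≡ ∣ S ∣ * c
∣∣-weighted {n} S c = begin
  sumFin n (λ a → ι (lookup S a) * c)  ≡⟨ sumFin-cong n (λ a → *-comm _ c) ⟩
  sumFin n (λ a → c * ι (lookup S a))  ≡⟨ sumFin-*ˡ n c _ ⟩
  c * sumFin n (λ a → ι (lookup S a))  ≡⟨ cong (c *_) (sym (∣∣-sumFin S)) ⟩
  c * ∣ S ∣                            ≡⟨ *-comm c ∣ S ∣ ⟩
  ∣ S ∣ * c                            ∎
  where open ≡-Reasoning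

module QuasiBipartiteBound {n} (r d : ℕ) (G : Hypergraph n) (uniform : Uniform r G) (regular : Regular d G)
  (A : Subset n) (one-in-A : ∀ e → IsEdge G e → ∣ e ∩ A ∣ ≡ 1)
  (matching : ∀ a → a ∈ A → ∀ e f → IsEdge G e → IsEdge G f → a ∈ e → a ∈ f → ¬ (e ≡ f) → Empty ((e - a) ∩ (f - a)))
  where

  open HypergraphFacts G

  links-count : ∀ a → length (links a) ≡ d
  links-count a = trans (length-map (_- a) (edgesAt a)) (regular a)

  links-size : ∀ a → All (λ T → ∣ T ∣ ≡ r ∸ 1) (links a)
  links-size a = All.map⁺ (All.tabulate λ {e} e∈ →
    let (edge , a∈e) = edgesAt⁻ e∈ in cong (_∸ 1) (trans (suc∣p-x∣≡∣p∣ e a∈e) (uniform e edge)))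

  links-disjoint : ∀ a → a ∈ A → AllPairs Disjoint (links a)
  links-disjoint a a∈A = AllPairs.map⁺ (allPairs-members (All.tabulate edgesAt⁻) (unique-edgesAt a)
    λ (e-edge , a∈e) (f-edge , a∈f) e≢f → Empty-unique (matching a a∈A _ _ e-edge f-edge a∈e a∈f e≢f))

  nbhd-size : ∀ a → a ∈ A → ∣ nbhd a ∣ ≡ d * (r ∸ 1)
  nbhd-size a a∈A = begin
    ∣ nbhd a ∣                  ≡⟨ ∣⋃∣-disjoint (links a) (links-disjoint a a∈A) ⟩
    sum (map ∣_∣ (links a))     ≡⟨ sum-const ∣_∣ (r ∸ 1) (links-size a) ⟩
    length (links a) * (r ∸ 1)  ≡⟨ cong (_* (r ∸ 1)) (links-count a) ⟩
    d * (r ∸ 1)                 ∎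
    where open ≡-Reasoning

  -- Choosing y ⊆ N(a) with a free means choosing a proper subset of each link edge.
  free-count : ∀ a → a ∈ A → sumSub (nbhd a) (ι ∘ free a) ≡ (2 ^ (r ∸ 1) ∸ 1) ^ d
  free-count a a∈A = begin
    sumSub (nbhd a) (ι ∘ free a)                ≡⟨ count-avoiding (links a) (links-disjoint a a∈A) ⟩
    product (map (λ T → 2 ^ ∣ T ∣ ∸ 1) (links a)) ≡⟨ product-const _ (2 ^ (r ∸ 1) ∸ 1) (All.map (cong (λ s → 2 ^ s ∸ 1)) (links-size a)) ⟩
    (2 ^ (r ∸ 1) ∸ 1) ^ length (links a)        ≡⟨ cong ((2 ^ (r ∸ 1) ∸ 1) ^_) (links-count a) ⟩
    (2 ^ (r ∸ 1) ∸ 1) ^ d                       ∎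
    where open ≡-Reasoning

  weight-sum : ∀ a → a ∈ A → sumSub (nbhd a) (λ y → suc (ι (free a y)) ^ d) ≡ indH r d
  weight-sum a a∈A = begin
    sumSub N (λ y → suc (ι (free a y)) ^ d)                       ≡⟨ sumSub-cong N (λ y → weight-power (free a y)) ⟩
    sumSub N (λ y → 1 + ι (free a y) * c)                         ≡⟨ sumSub-+ N (λ _ → 1) _ ⟩
    sumSub N (λ _ → 1) + sumSub N (λ y → ι (free a y) * c)        ≡⟨ cong₂ _+_ (sumSub-const N 1) (sumSub-*ʳ N c _) ⟩
    2 ^ ∣ N ∣ * 1 + sumSub N (ι ∘ free a) * c                     ≡⟨ cong₂ (λ s t → 2 ^ s * 1 + t * c) (nbhd-size a a∈A) (free-count a a∈A) ⟩
    2 ^ (d * (r ∸ 1)) * 1 + (2 ^ (r ∸ 1) ∸ 1) ^ d * c             ≡⟨ cong₂ _+_ (trans (*-identityʳ _) (cong (2 ^_) (*-comm d (r ∸ 1)))) (*-comm _ c) ⟩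
    indH r d                                                       ∎
    where
    open ≡-Reasoning
    N = nbhd a
    c = 2 ^ d ∸ 1
    weight-power : ∀ b → suc (ι b) ^ d ≡ 1 + ι b * c
    weight-power true = trans (sym (m+[n∸m]≡n (m^n>0 2 d))) (cong (1 +_) (sym (+-identityʳ c)))
    weight-power false = ^-zeroˡ d

  mask : Fin n → Subset n
  mask a = if lookup A a then nbhd a else ⊥

  -- Each v ∉ A lies in N(a) for exactly d vertices a ∈ A: each of the d edges
  -- through v contains exactly one vertex a of A, and distinct edges through v
  -- give distinct a (the links of a are disjoint).
  mask-coverage : ∀ v → lookup A v ≡ false → coverage n mask v ≡ d
  mask-coverage v v∉A = begin
    sumFin n (λ a → ι (lookup (mask a) v))
      ≡⟨ sumFin-cong n per-vertex ⟩
    sumFin n (λ a → ι (lookup A a) * sumSub ⊤ (λ e → ι (G e) * ι (lookup e v) * ι (lookup e a)))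
      ≡⟨ double-count A (λ e → ι (G e) * ι (lookup e v)) ⟩
    sumSub ⊤ (λ e → ι (G e) * ι (lookup e v) * ∣ e ∩ A ∣)
      ≡⟨ sumSub-cong ⊤ (λ e → one-A-vertex e (ι (lookup e v))) ⟩
    sumSub ⊤ (λ e → ι (G e) * ι (lookup e v))
      ≡⟨ sym (degree-sum v) ⟩
    degree G v
      ≡⟨ regular v ⟩
    d ∎
    where
    open ≡-Reasoning
    per-vertex : ∀ a → ι (lookup (mask a) v) ≡ ι (lookup A a) * sumSub ⊤ (λ e → ι (G e) * ι (lookup e v) * ι (lookup e a))
    per-vertex a with lookup A a in a∈A
    ... | false = cong ι (lookup-replicate v false)
    ... | true = trans (ι-⋃-disjoint (links a) (links-disjoint a (lookup⇒[]= a A a∈A)) v)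
                  (trans (sym (edges-through-both a v v≢a)) (sym (+-identityʳ _)))
      where
      v≢a : v ≢ a
      v≢a refl with trans (sym v∉A) a∈A
      ... | ()
    one-A-vertex : ∀ e x → ι (G e) * x * ∣ e ∩ A ∣ ≡ ι (G e) * x
    one-A-vertex e x with G e in edge
    ... | false = refl
    ... | true = trans (cong ((1 * x) *_) (one-in-A e edge)) (*-identityʳ (1 * x))

  -- Double counting the edges through A and through all vertices gives
  -- |A|·d = |E| and n·d = r·|E|, hence n = r·|A|.
  degree-count : ∀ S → ∣ S ∣ * d ≡ sumSub ⊤ (λ e → ι (G e) * ∣ e ∩ S ∣)
  degree-count S = begin
    ∣ S ∣ * d                                               ≡⟨ sym (∣∣-weighted S d) ⟩
    sumFin n (λ a → ι (lookup S a) * d)                     ≡⟨ sumFin-cong n (λ a → cong (ι (lookup S a) *_) (sym (trans (sym (degree-sum a)) (regular a)))) ⟩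
    sumFin n (λ a → ι (lookup S a) * sumSub ⊤ (λ e → ι (G e) * ι (lookup e a))) ≡⟨ double-count S (ι ∘ G) ⟩
    sumSub ⊤ (λ e → ι (G e) * ∣ e ∩ S ∣)                    ∎
    where open ≡-Reasoning

  vertex-count : NonZero d → r * ∣ A ∣ ≡ n
  vertex-count d≢0 = *-cancelʳ-≡ (r * ∣ A ∣) n d {{d≢0}} (begin
    r * ∣ A ∣ * d                               ≡⟨ *-assoc r ∣ A ∣ d ⟩
    r * (∣ A ∣ * d)                             ≡⟨ cong (r *_) (degree-count A) ⟩
    r * sumSub ⊤ (λ e → ι (G e) * ∣ e ∩ A ∣)    ≡⟨ sym (sumSub-*ˡ (⊤ {n}) r _) ⟩
    sumSub ⊤ (λ e → r * (ι (G e) * ∣ e ∩ A ∣))  ≡⟨ sumSub-cong ⊤ edge-sizes ⟩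
    sumSub ⊤ (λ e → ι (G e) * ∣ e ∩ ⊤ ∣)        ≡⟨ sym (degree-count (⊤ {n})) ⟩
    ∣ ⊤ {n} ∣ * d                               ≡⟨ cong (_* d) (∣⊤∣≡n n) ⟩
    n * d                                       ∎)
    where
    open ≡-Reasoning
    edge-sizes : ∀ e → r * (ι (G e) * ∣ e ∩ A ∣) ≡ ι (G e) * ∣ e ∩ ⊤ ∣
    edge-sizes e with G e in edge
    ... | false = *-zeroʳ r
    ... | true = begin
      r * (1 * ∣ e ∩ A ∣)  ≡⟨ cong (λ k → r * (1 * k)) (one-in-A e edge) ⟩
      r * 1                ≡⟨ *-identityʳ r ⟩
      r                    ≡⟨ sym (uniform e edge) ⟩
      ∣ e ∣                ≡⟨ cong ∣_∣ (sym (∩-identityʳ e)) ⟩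
      ∣ e ∩ ⊤ ∣            ≡⟨ sym (*-identityˡ _) ⟩
      1 * ∣ e ∩ ⊤ ∣        ∎

  weightᵈ : Fin n → Subset n → ℕ
  weightᵈ a y = merge (lookup A a) 1 (ι (free a y)) ^ d

  weightᵈ-local : ∀ a → DependsOn (mask a) (weightᵈ a)
  weightᵈ-local a x y eq with lookup A a
  ... | false = refl
  ... | true = cong (λ b → suc (ι b) ^ d) (free-local a x y eq)

  weightᵈ-sum : ∀ a → sumSub (mask a) (weightᵈ a) ≡ (if lookup A a then indH r d else 1)
  weightᵈ-sum a with lookup A a in a∈A
  ... | false = trans (sumSub-⊥ n (λ _ → 1 ^ d)) (^-zeroˡ d)
  ... | true = weight-sum a (lookup⇒[]= a A a∈A)

  ind-bound : .{{_ : NonZero d}} → ind G ^ d ≤ indH r d ^ ∣ A ∣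
  ind-bound = begin
    ind G ^ d                                          ≡⟨ cong (_^ d) (ind-split A) ⟩
    sumSub (∁ A) K ^ d                                 ≤⟨ finner d n (∁ A) n mask weightᵈ K coverage-B weightᵈ-local K-bound ⟩
    prodFin n (λ a → sumSub (mask a) (weightᵈ a))      ≡⟨ prodFin-cong n weightᵈ-sum ⟩
    prodFin n (λ a → if lookup A a then indH r d else 1) ≡⟨ prodFin-indicator A (indH r d) ⟩
    indH r d ^ ∣ A ∣                                   ∎
    where
    open ≤-Reasoning
    K : Subset n → ℕ
    K y = sumSub A (λ z → ι (isIndependent G (y ∪ z)))
    coverage-B : ∀ v → lookup (∁ A) v ≡ true → coverage n mask v ≡ d
    coverage-B v v∈B = mask-coverage v (trans (sym (not-involutive _)) (cong not (trans (sym (lookup-map v not A)) v∈B)))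
    K-bound : ∀ y → K y ^ d ≤ prodFin n (λ a → weightᵈ a y)
    K-bound y = ≤-trans (^-monoˡ-≤ d (extensions-bound A y)) (≤-reflexive (prodFin-^ n _ d))

-- ind(Hʳ_d) ≥ 1: it counts the empty set.
indH-positive : ∀ r d → 1 ≤ indH r d
indH-positive r d = ≤-trans (m^n>0 2 ((r ∸ 1) * d)) (m≤m+n _ _)

-- For d = 0 the left side is 1.  Otherwise raise ind(G)ᵈ ≤ ind(Hʳ_d)^|A| to
-- the r-th power and use n = r·|A|.  (The argument does not need r ≥ 2.)
mainTheorem1 : (r d n : ℕ) → 2 ≤ r → (G : Hypergraph n) →
    Uniform r G → Regular d G → QuasiBipartite G →
    ind G ^ (r * d) ≤ indH r d ^ n
mainTheorem1 r zero n _ G _ _ _ rewrite *-zeroʳ r =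
  subst (_≤ indH r 0 ^ n) (^-zeroˡ n) (^-monoˡ-≤ n (indH-positive r 0))
mainTheorem1 r d@(suc _) n _ G uniform regular (A , one-in-A , matching) = begin
  ind G ^ (r * d)       ≡⟨ trans (cong (ind G ^_) (*-comm r d)) (sym (^-*-assoc (ind G) d r)) ⟩
  (ind G ^ d) ^ r       ≤⟨ ^-monoˡ-≤ r ind-bound ⟩
  (indH r d ^ ∣A∣) ^ r  ≡⟨ ^-*-assoc (indH r d) ∣A∣ r ⟩
  indH r d ^ (∣A∣ * r)  ≡⟨ cong (indH r d ^_) (trans (*-comm ∣A∣ r) (vertex-count _)) ⟩
  indH r d ^ n          ∎
  where
  open ≤-Reasoning
  open QuasiBipartiteBound r d G uniform regular A one-in-A matching
  ∣A∣ = ∣ A ∣
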